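{- Let $\mathcal{R}$ be a set of analytic rules. The following rules are admissible in $\mathsf{ACT}_\omega+\mathcal{R}$: the generalized identity axiom $\alpha\Rightarrow\alpha$ for arbitrary formulas $\alpha$, and the rule $0\mathrm{R}$: from $\Gamma\Rightarrow 0$ infer $\Sigma_l,\Gamma,\Sigma_r\Rightarrow\beta$.
   Context: Formulas are terms over $\{\wedge,\vee,\cdot,\backslash,/,{}^*,0,1\}$ and sequents are $\Gamma\Rightarrow\beta$. An analytic rule has premises $\Gamma,\Upsilon_i,\Delta\Rightarrow\beta$ ($i<n$) and conclusion $\Gamma,\Upsilon,\Delta\Rightarrow\beta$, with $\Upsilon$ a sequence of distinct sequence metavariables (distinct from $\Gamma,\Delta$) and each $\Upsilon_i$ a sequence of metavariables from $\Upsilon$. $\mathsf{ACT}_\omega+\mathcal{R}$ is the wellfounded sequent system with the identity axiom $a\Rightarrow a$ for propositional variables $a$ only, the rules in $\mathcal{R}$, the rule $0\mathrm{L}$ ($\Gamma,0,\Delta\Rightarrow\beta$), standard left/right rules for $1,\wedge,\vee,\cdot,\backslash,/$, the right star rules ($\Rightarrow\beta^*$; from $\Gamma\Rightarrow\beta$ and $\Delta\Rightarrow\beta^*$ infer $\Gamma,\Delta\Rightarrow\beta^*$) and the $\omega$-rule (from $\Gamma,\alpha^{(n)},\Delta\Rightarrow\beta$ for all $n\in\mathbb{N}$ infer $\Gamma,\alpha^*,\Delta\Rightarrow\beta$). There is no Cut rule and no right rule for $0$. -}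

module Defs where

open import Data.Nat using (ℕ)
open import Data.Fin using (Fin)
open import Data.List using (List; []; _∷_; _++_; [_]; concatMap; replicate; allFin)
open import Data.List.Membership.Propositional using (_∈_)
open import Data.Product using (_×_; _,_)

infixr 30 _·_
infixr 20 _∧_
infixr 10 _∨_
data Fm : Set where
  var  : ℕ → Fm
  _∧_  : Fm → Fm → Fm
  _∨_  : Fm → Fm → Fm
  _·_  : Fm → Fm → Fm
  _⧵_  : Fm → Fm → Fm
  _╱_  : Fm → Fm → Fm
  _⋆   : Fm → Fm
  𝟎    : Fm
  𝟏    : Fm

Ctx : Set
Ctx = List Fm

record Seq : Set where
  constructor _⇒_
  field
    ant : Ctx
    suc : Fm
infix 4 _⇒_

-- An analytic rule. Υ consists of k distinct sequence metavariables,
-- named by Fin k and listed in the order 0,1,…,k-1.  Each premise Υᵢ is a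
-- (finite) sequence of metavariables from Υ; there are finitely many premises.
record Rule : Set where
  field
    k     : ℕ
    prems : List (List (Fin k))
open Rule

inst : {k : ℕ} → (Fin k → Ctx) → List (Fin k) → Ctx
inst σ = concatMap σ

pow : Fm → ℕ → Ctx
pow α n = replicate n α

data ACTω (R : Rule → Set) : Seq → Set where
  ax   : ∀ a → ACTω R ([ var a ] ⇒ var a)
  rule : ∀ (r : Rule) → R r → (σ : Fin (k r) → Ctx) (Γ Δ : Ctx) (β : Fm) →
         (∀ {Υᵢ} → Υᵢ ∈ prems r → ACTω R (Γ ++ inst σ Υᵢ ++ Δ ⇒ β)) →
         ACTω R (Γ ++ inst σ (allFin (k r)) ++ Δ ⇒ β)
  0L   : ∀ Γ Δ β → ACTω R (Γ ++ 𝟎 ∷ Δ ⇒ β)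
  1L   : ∀ Γ Δ β → ACTω R (Γ ++ Δ ⇒ β) → ACTω R (Γ ++ 𝟏 ∷ Δ ⇒ β)
  1R   : ACTω R ([] ⇒ 𝟏)
  ∧L₁  : ∀ Γ Δ α β γ → ACTω R (Γ ++ α ∷ Δ ⇒ γ) → ACTω R (Γ ++ (α ∧ β) ∷ Δ ⇒ γ)
  ∧L₂  : ∀ Γ Δ α β γ → ACTω R (Γ ++ β ∷ Δ ⇒ γ) → ACTω R (Γ ++ (α ∧ β) ∷ Δ ⇒ γ)
  ∧R   : ∀ Γ α β → ACTω R (Γ ⇒ α) → ACTω R (Γ ⇒ β) → ACTω R (Γ ⇒ α ∧ β)
  ∨L   : ∀ Γ Δ α β γ → ACTω R (Γ ++ α ∷ Δ ⇒ γ) → ACTω R (Γ ++ β ∷ Δ ⇒ γ) →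
         ACTω R (Γ ++ (α ∨ β) ∷ Δ ⇒ γ)
  ∨R₁  : ∀ Γ α β → ACTω R (Γ ⇒ α) → ACTω R (Γ ⇒ α ∨ β)
  ∨R₂  : ∀ Γ α β → ACTω R (Γ ⇒ β) → ACTω R (Γ ⇒ α ∨ β)
  ·L   : ∀ Γ Δ α β γ → ACTω R (Γ ++ α ∷ β ∷ Δ ⇒ γ) → ACTω R (Γ ++ (α · β) ∷ Δ ⇒ γ)
  ·R   : ∀ Γ Δ α β → ACTω R (Γ ⇒ α) → ACTω R (Δ ⇒ β) → ACTω R (Γ ++ Δ ⇒ α · β)
  ⧵L   : ∀ Γ Π Δ α β γ → ACTω R (Π ⇒ α) → ACTω R (Γ ++ β ∷ Δ ⇒ γ) →
         ACTω R (Γ ++ Π ++ (α ⧵ β) ∷ Δ ⇒ γ)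
  ⧵R   : ∀ Π α β → ACTω R (α ∷ Π ⇒ β) → ACTω R (Π ⇒ α ⧵ β)
  ╱L   : ∀ Γ Π Δ α β γ → ACTω R (Π ⇒ α) → ACTω R (Γ ++ β ∷ Δ ⇒ γ) →
         ACTω R (Γ ++ (β ╱ α) ∷ Π ++ Δ ⇒ γ)
  ╱R   : ∀ Π α β → ACTω R (Π ++ [ α ] ⇒ β) → ACTω R (Π ⇒ β ╱ α)
  ⋆R₀  : ∀ α → ACTω R ([] ⇒ α ⋆)
  ⋆R   : ∀ Γ Δ α → ACTω R (Γ ⇒ α) → ACTω R (Δ ⇒ α ⋆) → ACTω R (Γ ++ Δ ⇒ α ⋆)
  ω    : ∀ Γ Δ α β → ((n : ℕ) → ACTω R (Γ ++ pow α n ++ Δ ⇒ β)) →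
         ACTω R (Γ ++ (α ⋆) ∷ Δ ⇒ β)

-- Identity: induction on α; the only non-routine case is α*, which follows by
-- the ω-rule from α^(n) ⇒ α*, built from n identities by the right star rules.
--
-- 0R: nothing but a left rule can conclude Γ ⇒ 0 (there is no right rule for 0,
-- and the axiom is for variables only). Every left rule, analytic rules included,
-- acts on one slot of the antecedent and leaves the surrounding context and the
-- succedent arbitrary, so by induction on the derivation we may replace the
-- succedent 0 by β and add Σl and Σr around the antecedent throughout.
module Submission where

open import Defs
open import Data.List using ([]; _∷_; _++_; [_])
open import Data.List.Properties using (++-assoc; ++-identityʳ)
open import Data.Nat using (ℕ; zero; suc)
open import Data.Product using (_×_; _,_)
open import Relation.Binary.PropositionalEquality using (_≡_; sym; cong; subst; module ≡-Reasoning)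

module _ {R : Rule → Set} where

  castAnt : ∀ {Γ Δ β} → Γ ≡ Δ → ACTω R (Γ ⇒ β) → ACTω R (Δ ⇒ β)
  castAnt {β = β} = subst (λ Γ → ACTω R (Γ ⇒ β))

  identity : (α : Fm) → ACTω R ([ α ] ⇒ α)
  pow⇒star : (α : Fm) (n : ℕ) → ACTω R (pow α n ⇒ α ⋆)

  identity (var a) = ax a
  identity (α ∧ β) = ∧R _ α β (∧L₁ [] [] α β α (identity α)) (∧L₂ [] [] α β β (identity β))
  identity (α ∨ β) = ∨L [] [] α β _ (∨R₁ _ α β (identity α)) (∨R₂ _ α β (identity β))
  identity (α · β) = ·L [] [] α β _ (·R [ α ] [ β ] α β (identity α) (identity β))
  identity (α ⧵ β) = ⧵R _ α β (⧵L [] [ α ] [] α β β (identity α) (identity β))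
  identity (β ╱ α) = ╱R _ α β (╱L [] [ α ] [] α β β (identity α) (identity β))
  identity (α ⋆)   = ω [] [] α (α ⋆) λ n → castAnt (sym (++-identityʳ (pow α n))) (pow⇒star α n)
  identity 𝟎       = 0L [] [] 𝟎
  identity 𝟏       = 1L [] [] 𝟏 1R

  pow⇒star α zero    = ⋆R₀ α
  pow⇒star α (suc n) = ⋆R [ α ] (pow α n) α (identity α) (pow⇒star α n)

  frame : (Σl Γ X Δ Σr : Ctx) → Σl ++ (Γ ++ X ++ Δ) ++ Σr ≡ (Σl ++ Γ) ++ X ++ Δ ++ Σr
  frame Σl Γ X Δ Σr = begin
    Σl ++ (Γ ++ X ++ Δ) ++ Σr  ≡⟨ cong (Σl ++_) (++-assoc Γ (X ++ Δ) Σr) ⟩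
    Σl ++ Γ ++ (X ++ Δ) ++ Σr  ≡⟨ cong (λ Z → Σl ++ Γ ++ Z) (++-assoc X Δ Σr) ⟩
    Σl ++ Γ ++ X ++ Δ ++ Σr    ≡⟨ sym (++-assoc Σl Γ (X ++ Δ ++ Σr)) ⟩
    (Σl ++ Γ) ++ X ++ Δ ++ Σr  ∎
    where open ≡-Reasoning

  module ZeroRight (Σl Σr : Ctx) (β : Fm) where

    -- The slot X of each left rule is chosen so that its antecedent is
    -- definitionally Γ ++ X ++ Δ (e.g. X = (γ ╱ α) ∷ Π for ╱L, X = Π for ⧵L).
    framed : ∀ Γ X Δ → ACTω R ((Σl ++ Γ) ++ X ++ Δ ++ Σr ⇒ β) → ACTω R (Σl ++ (Γ ++ X ++ Δ) ++ Σr ⇒ β)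
    framed Γ X Δ = castAnt (sym (frame Σl Γ X Δ Σr))

    zero-right : ∀ {Γ} → ACTω R (Γ ⇒ 𝟎) → ACTω R (Σl ++ Γ ++ Σr ⇒ β)
    unframe : ∀ Γ X Δ → ACTω R (Γ ++ X ++ Δ ⇒ 𝟎) → ACTω R ((Σl ++ Γ) ++ X ++ Δ ++ Σr ⇒ β)
    unframe Γ X Δ d = castAnt (frame Σl Γ X Δ Σr) (zero-right d)

    zero-right (rule r r∈R σ Γ Δ _ ps) =
      framed Γ _ Δ (rule r r∈R σ (Σl ++ Γ) (Δ ++ Σr) β λ m → unframe Γ _ Δ (ps m))
    zero-right (0L Γ Δ _)            = framed Γ [ 𝟎 ] Δ (0L (Σl ++ Γ) (Δ ++ Σr) β)
    zero-right (1L Γ Δ _ d)          = framed Γ [ 𝟏 ] Δ (1L (Σl ++ Γ) (Δ ++ Σr) β (unframe Γ [] Δ d))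
    zero-right (∧L₁ Γ Δ α γ _ d)     = framed Γ _ Δ (∧L₁ (Σl ++ Γ) (Δ ++ Σr) α γ β (unframe Γ _ Δ d))
    zero-right (∧L₂ Γ Δ α γ _ d)     = framed Γ _ Δ (∧L₂ (Σl ++ Γ) (Δ ++ Σr) α γ β (unframe Γ _ Δ d))
    zero-right (∨L Γ Δ α γ _ d e)    =
      framed Γ _ Δ (∨L (Σl ++ Γ) (Δ ++ Σr) α γ β (unframe Γ _ Δ d) (unframe Γ _ Δ e))
    zero-right (·L Γ Δ α γ _ d)      =
      framed Γ _ Δ (·L (Σl ++ Γ) (Δ ++ Σr) α γ β (unframe Γ (α ∷ γ ∷ []) Δ d))
    zero-right (⧵L Γ Π Δ α γ _ p d)  =
      framed Γ Π _ (⧵L (Σl ++ Γ) Π (Δ ++ Σr) α γ β p (unframe Γ _ Δ d))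
    zero-right (╱L Γ Π Δ α γ _ p d)  =
      framed Γ ((γ ╱ α) ∷ Π) Δ (╱L (Σl ++ Γ) Π (Δ ++ Σr) α γ β p (unframe Γ _ Δ d))
    zero-right (ω Γ Δ α _ f)         =
      framed Γ _ Δ (ω (Σl ++ Γ) (Δ ++ Σr) α β λ n → unframe Γ (pow α n) Δ (f n))

lemmal : (R : Rule → Set) →
    ((α : Fm) → ACTω R ([ α ] ⇒ α)) ×
    ((Γ Σl Σr : Ctx) (β : Fm) → ACTω R (Γ ⇒ 𝟎) → ACTω R (Σl ++ Γ ++ Σr ⇒ β))
lemmal R = identity , λ Γ Σl Σr β → ZeroRight.zero-right Σl Σr β
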